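{- Let $\ell$ and $n$ be integers with $\ell\geq 1$ and $n> e^{\ell+2}$. Then $\pi_l(G_{n,\ell})>\ell$.
   Context: $G_{n,\ell}$ is the graph with vertex set $\{v_{2i-1}: i\in[n]\}\cup\{v_{2i}^j : i\in[n],\ j\in[\binom{\ell n}{\ell}]\}$, where two vertices are adjacent if and only if their lower indices differ by exactly $1$ (i.e. it is obtained from a path on $2n$ vertices by replacing every second vertex by an independent set of $\binom{\ell n}{\ell}$ vertices). Here $[m]=\{1,\dots,m\}$. A vertex coloring $\phi$ of a graph $G$ is nonrepetitive if there is no path (with no repeated vertices) $u_1\ldots u_{2r}$, $r\geq1$, with $\phi(u_i)=\phi(u_{r+i})$ for all $i\in[r]$. The Thue choice number $\pi_l(G)$ is the minimum $\ell$ such that for every assignment of lists $L_v$ with $|L_v|\geq\ell$ for all $v\in V(G)$ there is a nonrepetitive coloring $\phi$ of $G$ with $\phi(v)\in L_v$ for all $v$. -}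

module Defs where

open import Data.Nat using (ℕ; zero; suc; _+_; _*_; _^_; _≤_; _<_)
open import Data.Nat.Combinatorics using (_C_)
open import Data.Fin using (Fin; toℕ; _↑ˡ_; _↑ʳ_)
open import Data.List using (List; length)
open import Data.List.Membership.Propositional using (_∈_)
open import Data.List.Relation.Unary.Unique.Propositional using (Unique)
open import Data.Product using (Σ; ∃; _×_)
open import Data.Sum using (_⊎_)
open import Relation.Nullary using (¬_)
open import Relation.Binary.PropositionalEquality using (_≡_)
open import Function.Definitions using (Injective)

record Graph : Set₁ where
  field
    Vertex : Set
    Adj    : Vertex → Vertex → Set
open Graph public

record IsPath (G : Graph) (m : ℕ) (p : Fin m → Vertex G) : Set where
  field
    distinct    : Injective _≡_ _≡_ p
    consecutive : (a b : Fin m) → toℕ b ≡ suc (toℕ a) → Adj G (p a) (p b)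

Repetitive : (G : Graph) (φ : Vertex G → ℕ) → Set
Repetitive G φ =
  Σ ℕ λ r → (1 ≤ r) × Σ (Fin (r + r) → Vertex G) λ p →
    IsPath G (r + r) p × ((i : Fin r) → φ (p (i ↑ˡ r)) ≡ φ (p (r ↑ʳ i)))

Nonrepetitive : (G : Graph) (φ : Vertex G → ℕ) → Set
Nonrepetitive G φ = ¬ Repetitive G φ

-- Lists of colours (colours are natural numbers); a list L_v is a finite set
-- of colours, represented as a duplicate-free list, so |L_v| = length.
ListAssignment : Graph → Set
ListAssignment G = Vertex G → List ℕ

NonrepChoosable : Graph → ℕ → Set
NonrepChoosable G k =
  (L : ListAssignment G) →
  ((v : Vertex G) → Unique (L v) × k ≤ length (L v)) →
  Σ (Vertex G → ℕ) λ φ → ((v : Vertex G) → φ v ∈ L v) × Nonrepetitive G φ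

-- π_l(G) > ℓ  ⟺  no k ≤ ℓ has the choosability property
-- (π_l is the minimum k with NonrepChoosable G k).
ThueChoiceNumberExceeds : Graph → ℕ → Set
ThueChoiceNumberExceeds G ℓ = (k : ℕ) → k ≤ ℓ → ¬ NonrepChoosable G k

-- The graph G_{n,ℓ}.  Vertices (0-based i : Fin n):
--   odd  i   represents v_{2(i+1)-1}, lower index 2i+1
--   even i j represents v_{2(i+1)}^{j+1}, lower index 2i+2, j ∈ [binom(ℓn, ℓ)]
data GVertex (n ℓ : ℕ) : Set where
  odd  : Fin n → GVertex n ℓ
  even : Fin n → Fin ((ℓ * n) C ℓ) → GVertex n ℓ

lowerIndex : ∀ {n ℓ} → GVertex n ℓ → ℕ
lowerIndex (odd i)    = suc (2 * toℕ i)
lowerIndex (even i j) = suc (suc (2 * toℕ i))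

G : ℕ → ℕ → Graph
G n ℓ = record
  { Vertex = GVertex n ℓ
  ; Adj    = λ u v → (suc (lowerIndex u) ≡ lowerIndex v) ⊎ (suc (lowerIndex v) ≡ lowerIndex u)
  }

-- e^k < n, expressed without reals: the sequence (1 + 1/m)^(m+1) (m ≥ 1)
-- decreases strictly to e, so e^k < n iff for some m ≥ 1,
-- ((m+1)/m)^((m+1)k) < n, i.e. (m+1)^((m+1)k) < n * m^((m+1)k).
ExpLessThan : ℕ → ℕ → Set
ExpLessThan k n = Σ ℕ λ m → (1 ≤ m) × ((suc m) ^ (suc m * k) < n * m ^ (suc m * k))

-- Give the odd vertex v_{2k+1} the colours kℓ, …, kℓ+ℓ-1 and every vertex of
-- the k-th independent set its own ℓ-subset of [ℓn].  In a nonrepetitive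
-- colouring each independent set misses fewer than ℓ colours of [ℓn] (an ℓ-set
-- of missing colours is the list of one of its vertices), so there are fewer
-- than nℓ pairs (set, missing colour).  Split the path into windows of odd
-- length d = 2s+1 starting at multiples of d.  In each window some pair of
-- positions at distance d must consist of an odd vertex and a set missing its
-- colour, since otherwise the window carries a repetitively coloured path; and
-- the pair determines the window.  But there are Σ_{d≤n} (⌊n/d⌋ - 1) ≥
-- (n+1)·H_n - 2n windows, and H_n > ℓ+2 once n > e^{ℓ+2}, so there are more
-- than nℓ windows.  The logarithm is avoided through weighted AM–GM, which gives
-- (1+1/d)^d ≤ (1+1/m)^{m+1} and hence n+1 = ∏_{d≤n} (1+1/d) ≤ (1+1/m)^{(m+1)·H_n}.

module Submission where

open import Defs
open import Data.Empty using (⊥-elim)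
open import Data.Fin using (Fin; zero; suc; toℕ; fromℕ<; _↑ˡ_; _↑ʳ_; splitAt; join; cast)
open import Data.Fin.Properties
  using ( toℕ<n; toℕ-fromℕ<; toℕ-injective; toℕ-↑ˡ; toℕ-↑ʳ; splitAt-↑ˡ; splitAt-↑ʳ; splitAt⁻¹-↑ˡ; splitAt⁻¹-↑ʳ
        ; splitAt-join; cast-involutive; injective⇒≤; all?; ¬∀⟶∃¬ )
open import Data.List.Base using (List; []; _∷_; length; lookup; map; _++_; filter; downFrom; applyDownFrom; allFin)
open import Data.List.Properties using (length-++; length-map; length-downFrom; length-tabulate)
open import Data.List.Membership.Propositional using (_∈_)
open import Data.List.Membership.Propositional.Properties
  using (∈-lookup; ∈-map⁻; ∈-map⁺; ∈-++⁻; ∈-++⁺ˡ; ∈-++⁺ʳ; ∈-filter⁺; ∈-downFrom⁻; ∈-downFrom⁺; ∈-allFin)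
open import Data.List.Relation.Unary.All as All using (All; []; _∷_)
open import Data.List.Relation.Unary.Any as Any using (here; there)
open import Data.List.Relation.Unary.Any.Properties using (lookup-index)
open import Data.List.Relation.Unary.Unique.Propositional using (Unique; []; _∷_)
open import Data.List.Relation.Unary.Unique.Propositional.Properties using (map⁺; downFrom⁺; ++⁺)
open import Data.Nat.Base using (ℕ; zero; suc; _+_; _*_; _∸_; _^_; _≤_; _<_; _!; _/_; _%_; z≤n; s≤s; s≤s⁻¹; NonZero; >-nonZero)
open import Data.Nat.Properties
open import Data.Nat.Combinatorics using (_C_; nCk+nC[k+1]≡[n+1]C[k+1])
open import Data.Nat.DivMod using (m≡m%n+[m/n]*n; m%n<n; m*[n/m]≡n; m/n*n≤m; +-distrib-/-∣ˡ; m*n/n≡m; m<n⇒m/n≡0)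
open import Data.Nat.Divisibility using (_∣_; ∣-trans; m∣m*n; n∣m*n; m≤n⇒m!∣n!)
open import Data.Nat.ListAction using (sum)
open import Data.Nat.Tactic.RingSolver using (solve-∀)
open import Data.Product using (∃-syntax; ∃₂; _×_; _,_; proj₁; proj₂; map₁; map₂)
open import Data.Sum using (_⊎_; inj₁; inj₂; [_,_]′)
open import Function using (_∘_; id)
open import Relation.Nullary using (¬_; Dec; yes; no; ¬?)
open import Relation.Nullary.Decidable using (decidable-stable)
open import Relation.Unary using (Decidable)
open import Relation.Binary.PropositionalEquality

-- Weighted AM–GM

^-distrib-* : ∀ m n o → (m * n) ^ o ≡ m ^ o * n ^ o
^-distrib-* m n zero    = refl
^-distrib-* m n (suc o) = trans (cong (m * n *_) (^-distrib-* m n o)) ([m*n]*[o*p]≡[m*o]*[n*p] m n (m ^ o) (n ^ o))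

rearrangement : ∀ {a b c d} → a ≤ b → c ≤ d → a * d + b * c ≤ a * c + b * d
rearrangement {a} {b} {c} {d} a≤b c≤d
  with u , refl ← m≤n⇒∃[o]m+o≡n a≤b | v , refl ← m≤n⇒∃[o]m+o≡n c≤d = begin
  a * (c + v) + (a + u) * c         ≤⟨ m≤m+n _ (u * v) ⟩
  a * (c + v) + (a + u) * c + u * v ≡⟨ expand a c u v ⟩
  a * c + (a + u) * (c + v)         ∎
  where
  open ≤-Reasoning
  expand : ∀ a c u v → a * (c + v) + (a + u) * c + u * v ≡ a * c + (a + u) * (c + v)
  expand = solve-∀

power-rearrangement : ∀ p x y → x * y ^ p + y * x ^ p ≤ x ^ suc p + y ^ suc p
power-rearrangement p x y with ≤-total x y
... | inj₁ x≤y = rearrangement x≤y (^-monoˡ-≤ p x≤y)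
... | inj₂ y≤x = subst₂ _≤_ (+-comm (y * x ^ p) _) (+-comm (y * y ^ p) _) (rearrangement y≤x (^-monoˡ-≤ p y≤x))

power-mean : ∀ p x y → suc p * x * y ^ p ≤ x ^ suc p + p * y ^ suc p
power-mean zero    x y = ≤-reflexive (base x)
  where
  base : ∀ x → 1 * x * 1 ≡ x * 1 + 0
  base = solve-∀
power-mean (suc p) x y = begin
  suc (suc p) * x * y ^ suc p                           ≡⟨ split p x y (y ^ p) ⟩
  y * (suc p * x * y ^ p) + x * y ^ suc p               ≤⟨ +-monoˡ-≤ _ (*-monoʳ-≤ y (power-mean p x y)) ⟩
  y * (x ^ suc p + p * y ^ suc p) + x * y ^ suc p       ≡⟨ regroup p x y (x ^ suc p) (y ^ suc p) ⟩
  x * y ^ suc p + y * x ^ suc p + p * y ^ suc (suc p)   ≤⟨ +-monoˡ-≤ _ (power-rearrangement (suc p) x y) ⟩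
  x ^ suc (suc p) + y ^ suc (suc p) + p * y ^ suc (suc p) ≡⟨ +-assoc (x ^ suc (suc p)) _ _ ⟩
  x ^ suc (suc p) + suc p * y ^ suc (suc p)             ∎
  where
  open ≤-Reasoning
  split : ∀ p x y Y → suc (suc p) * x * (y * Y) ≡ y * (suc p * x * Y) + x * (y * Y)
  split = solve-∀
  regroup : ∀ p x y X Y → y * (X + p * Y) + x * Y ≡ x * Y + y * X + p * (y * Y)
  regroup = solve-∀

am-gm₁ : ∀ p a b → suc p ^ suc p * (a ^ p * b) ≤ (p * a + b) ^ suc p
am-gm₁ p a b = +-cancelʳ-≤ (p * y ^ suc p) _ _ (begin
  suc p ^ suc p * (a ^ p * b) + p * y ^ suc p              ≡⟨ cong (λ Y → suc p ^ suc p * (a ^ p * b) + p * (y * Y))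
                                                                   (^-distrib-* (suc p) a p) ⟩
  suc p * P * (A * b) + p * (y * (P * A))                  ≡⟨ merge p a b P A ⟩
  suc p * (p * a + b) * (P * A)                            ≡⟨ cong (suc p * (p * a + b) *_) (^-distrib-* (suc p) a p) ⟨
  suc p * (p * a + b) * y ^ p                              ≤⟨ power-mean p (p * a + b) y ⟩
  (p * a + b) ^ suc p + p * y ^ suc p                      ∎)
  where
  open ≤-Reasoning
  y P A : ℕ
  y = suc p * a
  P = suc p ^ p
  A = a ^ p
  merge : ∀ p a b P A → suc p * P * (A * b) + p * (suc p * a * (P * A)) ≡ suc p * (p * a + b) * (P * A)
  merge = solve-∀

am-gm₂-step : ∀ p q a b .{{_ : NonZero (p + q)}} →
              (p + q) ^ (p + q) * (a ^ p * b ^ q) ≤ (p * a + q * b) ^ (p + q) →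
              suc (p + q) ^ suc (p + q) * (a ^ suc p * b ^ q) ≤ (suc p * a + q * b) ^ suc (p + q)
am-gm₂-step p q a b ih = *-cancelˡ-≤ (r ^ suc r) {{m^n≢0 r (suc r)}} (begin
  r ^ suc r * (suc r ^ suc r * (a ^ suc p * b ^ q))      ≡⟨ shuffle r a (r ^ r) (suc r ^ suc r) (a ^ p) (b ^ q) ⟩
  suc r ^ suc r * (r ^ r * (a ^ p * b ^ q) * (r * a))    ≤⟨ *-monoʳ-≤ (suc r ^ suc r) (*-monoˡ-≤ (r * a) ih) ⟩
  suc r ^ suc r * (s ^ r * (r * a))                      ≤⟨ am-gm₁ r s (r * a) ⟩
  (r * s + r * a) ^ suc r                                ≡⟨ cong (_^ suc r) (factor p q a b) ⟩
  (r * (suc p * a + q * b)) ^ suc r                      ≡⟨ ^-distrib-* r _ (suc r) ⟩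
  r ^ suc r * (suc p * a + q * b) ^ suc r                ∎)
  where
  open ≤-Reasoning
  r s : ℕ
  r = p + q
  s = p * a + q * b
  shuffle : ∀ r a R S A B → r * R * (S * (a * A * B)) ≡ S * (R * (A * B) * (r * a))
  shuffle = solve-∀
  factor : ∀ p q a b → (p + q) * (p * a + q * b) + (p + q) * a ≡ (p + q) * (suc p * a + q * b)
  factor = solve-∀

am-gm₂ : ∀ p q a b → (p + q) ^ (p + q) * (a ^ p * b ^ q) ≤ (p * a + q * b) ^ (p + q)
am-gm₂ zero             q         a b = ≤-reflexive (trans (cong (q ^ q *_) (*-identityˡ (b ^ q))) (sym (^-distrib-* q b q)))
am-gm₂ (suc zero)       zero      a b = ≤-reflexive (single a)
  where
  single : ∀ a → 1 * (a * 1 * 1) ≡ (1 * a + 0) * 1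
  single = solve-∀
am-gm₂ (suc zero)       q@(suc _) a b = am-gm₂-step zero q a b (am-gm₂ zero q a b)
am-gm₂ (suc p@(suc _))  q         a b = am-gm₂-step p q a b (am-gm₂ p q a b)

-- AM–GM for d copies of (d+1)/d and m+1 copies of m/(m+1), whose mean is 1.
[1+1/d]^d≤[1+1/m]^[1+m] : ∀ d m .{{_ : NonZero d}} → suc d ^ d * m ^ suc m ≤ d ^ d * suc m ^ suc m
[1+1/d]^d≤[1+1/m]^[1+m] d m = *-cancelˡ-≤ o {{o≢0}} (begin
  o * (suc d ^ d * m ^ suc m)                               ≡⟨ shuffle (r ^ r) (d ^ suc m) (m ^ suc m) (suc d ^ d) (suc m ^ d) ⟩
  r ^ r * ((d ^ suc m * m ^ suc m) * (suc d ^ d * suc m ^ d)) ≡⟨ inner (^-distrib-* d m (suc m)) (^-distrib-* (suc d) (suc m) d) ⟨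
  r ^ r * ((d * m) ^ suc m * (suc d * suc m) ^ d)           ≤⟨ am-gm₂ (suc m) d (d * m) (suc d * suc m) ⟩
  (suc m * (d * m) + d * (suc d * suc m)) ^ r               ≡⟨ cong (_^ r) (mean d m) ⟩
  (r * (d * suc m)) ^ r                                     ≡⟨ ^-distrib-* r (d * suc m) r ⟩
  r ^ r * (d * suc m) ^ r                                   ≡⟨ cong (r ^ r *_) (^-distrib-* d (suc m) r) ⟩
  r ^ r * (d ^ r * suc m ^ r)                               ≡⟨ inner (^-distribˡ-+-* d (suc m) d) (^-distribˡ-+-* (suc m) (suc m) d) ⟩
  r ^ r * ((d ^ suc m * d ^ d) * (suc m ^ suc m * suc m ^ d)) ≡⟨ unshuffle (r ^ r) (d ^ suc m) (d ^ d) (suc m ^ suc m) (suc m ^ d) ⟩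
  o * (d ^ d * suc m ^ suc m)                               ∎)
  where
  open ≤-Reasoning
  r o : ℕ
  r = suc m + d
  o = r ^ r * (d ^ suc m * suc m ^ d)
  inner : ∀ {x x′ y y′} → x ≡ x′ → y ≡ y′ → r ^ r * (x * y) ≡ r ^ r * (x′ * y′)
  inner = cong₂ (λ x y → r ^ r * (x * y))
  o≢0 : NonZero o
  o≢0 = m*n≢0 (r ^ r) _ {{m^n≢0 r r}} {{m*n≢0 _ _ {{m^n≢0 d (suc m)}} {{m^n≢0 (suc m) d}}}}
  shuffle : ∀ R D M S T → R * (D * T) * (S * M) ≡ R * ((D * M) * (S * T))
  shuffle = solve-∀
  mean : ∀ d m → suc m * (d * m) + d * (suc d * suc m) ≡ (suc m + d) * (d * suc m)
  mean = solve-∀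
  unshuffle : ∀ R D E S T → R * ((D * E) * (S * T)) ≡ R * (D * T) * (E * S)
  unshuffle = solve-∀

-- Harmonic sums

-- D · H_N whenever every i + 1 ≤ N divides D.
scaledHarmonic : ℕ → ℕ → ℕ
scaledHarmonic D N = sum (applyDownFrom (λ i → D / suc i) N)

[x^d]^[D/d]≡x^D : ∀ x {d D} .{{_ : NonZero d}} → d ∣ D → (x ^ d) ^ (D / d) ≡ x ^ D
[x^d]^[D/d]≡x^D x {d} {D} d∣D = trans (^-*-assoc x d (D / d)) (cong (x ^_) (m*[n/m]≡n d∣D))

-- N + 1 ≤ (1 + 1/m)^{(m+1)·H_N}, raised to the power D to clear denominators.
log[1+N]≤harmonic : ∀ m D N → (∀ {i} → i < N → suc i ∣ D) →
                    suc N ^ D * (m ^ suc m) ^ scaledHarmonic D N ≤ (suc m ^ suc m) ^ scaledHarmonic D N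
log[1+N]≤harmonic m D zero    _       = ≤-reflexive (cong (_* 1) (^-zeroˡ D))
log[1+N]≤harmonic m D (suc N) divides = begin
  suc d ^ D * B ^ (q + H)          ≡⟨ cong (suc d ^ D *_) (^-distribˡ-+-* B q H) ⟩
  suc d ^ D * (B ^ q * B ^ H)      ≡⟨ *-assoc (suc d ^ D) _ _ ⟨
  suc d ^ D * B ^ q * B ^ H        ≡⟨ cong (_* B ^ H) (spread (suc d) B) ⟨
  (suc d ^ d * B) ^ q * B ^ H      ≤⟨ *-monoˡ-≤ (B ^ H) (^-monoˡ-≤ q ([1+1/d]^d≤[1+1/m]^[1+m] d m)) ⟩
  (d ^ d * A) ^ q * B ^ H          ≡⟨ cong (_* B ^ H) (spread d A) ⟩
  d ^ D * A ^ q * B ^ H            ≡⟨ swap (d ^ D) (A ^ q) (B ^ H) ⟩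
  A ^ q * (d ^ D * B ^ H)          ≤⟨ *-monoʳ-≤ (A ^ q) (log[1+N]≤harmonic m D N (divides ∘ m<n⇒m<1+n)) ⟩
  A ^ q * A ^ H                    ≡⟨ ^-distribˡ-+-* A q H ⟨
  A ^ (q + H)                      ∎
  where
  open ≤-Reasoning
  d q H A B : ℕ
  d = suc N
  q = D / d
  H = scaledHarmonic D N
  A = suc m ^ suc m
  B = m ^ suc m
  spread : ∀ x y → (x ^ d * y) ^ q ≡ x ^ D * y ^ q
  spread x y = trans (^-distrib-* (x ^ d) y q) (cong (_* y ^ q) ([x^d]^[D/d]≡x^D x (divides ≤-refl)))
  swap : ∀ x y z → x * y * z ≡ y * (x * z)
  swap = solve-∀

x*b^h≤a^h⇒x*b^h′≤a^h′ : ∀ {x a b h h′} → x * b ^ h ≤ a ^ h → b ≤ a → h ≤ h′ → x * b ^ h′ ≤ a ^ h′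
x*b^h≤a^h⇒x*b^h′≤a^h′ {x} {a} {b} {h} x*b^h≤a^h b≤a h≤h′ with u , refl ← m≤n⇒∃[o]m+o≡n h≤h′ = begin
  x * b ^ (h + u)        ≡⟨ cong (x *_) (^-distribˡ-+-* b h u) ⟩
  x * (b ^ h * b ^ u)    ≡⟨ *-assoc x _ _ ⟨
  x * b ^ h * b ^ u      ≤⟨ *-mono-≤ x*b^h≤a^h (^-monoˡ-≤ u b≤a) ⟩
  a ^ h * a ^ u          ≡⟨ ^-distribˡ-+-* a h u ⟨
  a ^ (h + u)            ∎
  where open ≤-Reasoning

1+i∣n! : ∀ {i n} → i < n → suc i ∣ n !
1+i∣n! {i} i<n = ∣-trans (m∣m*n (i !)) (m≤n⇒m!∣n! i<n)

-- If H_n ≤ L then n + 1 ≤ (1 + 1/m)^{(m+1)·L} < n.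
harmonic-exceeds : ∀ L n → ExpLessThan L n → L * n ! < scaledHarmonic (n !) n
harmonic-exceeds L n (m , _ , [1+m]^[[1+m]L]<n*m^[[1+m]L]) = ≰⇒> λ H≤LD → <-irrefl refl (begin-strict
  suc n ^ D * B ^ (L * D)   ≤⟨ x*b^h≤a^h⇒x*b^h′≤a^h′ {x = suc n ^ D} (log[1+N]≤harmonic m D n 1+i∣n!) B≤A H≤LD ⟩
  A ^ (L * D)               <⟨ A^[LD]<n^D*B^[LD] ⟩
  n ^ D * B ^ (L * D)       ≤⟨ *-monoˡ-≤ (B ^ (L * D)) (^-monoˡ-≤ D (n≤1+n n)) ⟩
  suc n ^ D * B ^ (L * D)   ∎)
  where
  open ≤-Reasoning
  D A B : ℕ
  D = n !
  A = suc m ^ suc m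
  B = m ^ suc m
  B≤A : B ≤ A
  B≤A = ^-monoˡ-≤ (suc m) (n≤1+n m)
  A^L<n*B^L : A ^ L < n * B ^ L
  A^L<n*B^L = subst₂ _<_ (sym (^-*-assoc (suc m) (suc m) L)) (cong (n *_) (sym (^-*-assoc m (suc m) L)))
                [1+m]^[[1+m]L]<n*m^[[1+m]L]
  A^[LD]<n^D*B^[LD] : A ^ (L * D) < n ^ D * B ^ (L * D)
  A^[LD]<n^D*B^[LD] = subst₂ _<_ (^-*-assoc A L D) (trans (^-distrib-* n (B ^ L) D) (cong (n ^ D *_) (^-*-assoc B L D)))
                        (^-monoˡ-< D {{n !≢0}} A^L<n*B^L)

windowCount : ℕ → ℕ → ℕ
windowCount n S = sum (applyDownFrom (λ s → n / suc s ∸ 1) S)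

1+n≤[n/d∸1+2]*d : ∀ n d .{{_ : NonZero d}} → suc n ≤ (n / d ∸ 1 + 2) * d
1+n≤[n/d∸1+2]*d n d = begin
  suc n                      ≡⟨ cong suc (m≡m%n+[m/n]*n n d) ⟩
  suc (n % d + n / d * d)    ≤⟨ +-monoˡ-≤ (n / d * d) (m%n<n n d) ⟩
  suc (n / d) * d            ≤⟨ *-monoˡ-≤ d (1+x≤x∸1+2 (n / d)) ⟩
  (n / d ∸ 1 + 2) * d        ∎
  where
  open ≤-Reasoning
  1+x≤x∸1+2 : ∀ x → suc x ≤ x ∸ 1 + 2
  1+x≤x∸1+2 zero    = s≤s z≤n
  1+x≤x∸1+2 (suc x) = ≤-reflexive (+-comm 2 x)

-- Termwise ⌊n/d⌋ - 1 ≥ (n+1)/d - 2, scaled by D.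
harmonic≤windowCount : ∀ n D N → (∀ {i} → i < N → suc i ∣ D) →
                       suc n * scaledHarmonic D N ≤ D * windowCount n N + N * (2 * D)
harmonic≤windowCount n D zero    _       = ≤-trans (≤-reflexive (*-zeroʳ (suc n))) z≤n
harmonic≤windowCount n D (suc N) divides = begin
  suc n * (D / d + H)                                  ≡⟨ *-distribˡ-+ (suc n) (D / d) H ⟩
  suc n * (D / d) + suc n * H                          ≤⟨ +-mono-≤ term (harmonic≤windowCount n D N (divides ∘ m<n⇒m<1+n)) ⟩
  (D * w + 2 * D) + (D * windowCount n N + N * (2 * D)) ≡⟨ regroup D w (windowCount n N) N ⟩
  D * (w + windowCount n N) + suc N * (2 * D)          ∎
  where
  open ≤-Reasoning
  d w H : ℕ
  d = suc N
  w = n / d ∸ 1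
  H = scaledHarmonic D N
  term : suc n * (D / d) ≤ D * w + 2 * D
  term = begin
    suc n * (D / d)            ≤⟨ *-monoˡ-≤ (D / d) (1+n≤[n/d∸1+2]*d n d) ⟩
    (w + 2) * d * (D / d)      ≡⟨ *-assoc (w + 2) d (D / d) ⟩
    (w + 2) * (d * (D / d))    ≡⟨ cong ((w + 2) *_) (m*[n/m]≡n (divides ≤-refl)) ⟩
    (w + 2) * D                ≡⟨ distrib w D ⟩
    D * w + 2 * D              ∎
    where
    distrib : ∀ w D → (w + 2) * D ≡ D * w + 2 * D
    distrib = solve-∀
  regroup : ∀ D w W N → (D * w + 2 * D) + (D * W + N * (2 * D)) ≡ D * (w + W) + suc N * (2 * D)
  regroup = solve-∀

windowCount-exceeds : ∀ K n → (K + 2) * n ! < scaledHarmonic (n !) n → n * K < windowCount n n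
windowCount-exceeds K n [K+2]D<H = +-cancelʳ-< (2 * n) (n * K) (windowCount n n) (begin-strict
  n * K + 2 * n            ≤⟨ m≤m+n (n * K + 2 * n) (K + 2) ⟩
  n * K + 2 * n + (K + 2)  ≡⟨ expand K n ⟨
  suc n * (K + 2)          <⟨ *-cancelˡ-< D _ _ scaled ⟩
  windowCount n n + 2 * n  ∎)
  where
  open ≤-Reasoning
  D : ℕ
  D = n !
  expand : ∀ K n → suc n * (K + 2) ≡ n * K + 2 * n + (K + 2)
  expand = solve-∀
  reorder : ∀ D n K → D * (suc n * (K + 2)) ≡ suc n * ((K + 2) * D)
  reorder = solve-∀
  factor : ∀ D S n → D * S + n * (2 * D) ≡ D * (S + 2 * n)
  factor = solve-∀
  scaled : D * (suc n * (K + 2)) < D * (windowCount n n + 2 * n)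
  scaled = begin-strict
    D * (suc n * (K + 2))                 ≡⟨ reorder D n K ⟩
    suc n * ((K + 2) * D)                 <⟨ *-monoʳ-< (suc n) [K+2]D<H ⟩
    suc n * scaledHarmonic D n            ≤⟨ harmonic≤windowCount n D n 1+i∣n! ⟩
    D * windowCount n n + n * (2 * D)     ≡⟨ factor D (windowCount n n) n ⟩
    D * (windowCount n n + 2 * n)         ∎

-- Finite counting

∃-of-¬∀¬ : ∀ {m} {P : Fin m → Set} → Decidable P → ¬ (∀ i → ¬ P i) → ∃[ i ] P i
∃-of-¬∀¬ P? ¬∀¬ with i , ¬¬Pi ← ¬∀⟶∃¬ _ _ (¬? ∘ P?) ¬∀¬ = i , decidable-stable (P? i) ¬¬Pi

module _ {A : Set} where

  lookup-injective : ∀ {xs : List A} → Unique xs → ∀ {i j} → lookup xs i ≡ lookup xs j → i ≡ j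
  lookup-injective (_  ∷ _) {zero}  {zero}  _  = refl
  lookup-injective (x∉ ∷ _) {zero}  {suc j} eq = ⊥-elim (All.lookup x∉ (∈-lookup j) eq)
  lookup-injective (x∉ ∷ _) {suc i} {zero}  eq = ⊥-elim (All.lookup x∉ (∈-lookup i) (sym eq))
  lookup-injective (_  ∷ u) {suc i} {suc j} eq = cong suc (lookup-injective u eq)

  length-≤-by-injection : ∀ {B : Set} {R : A → B → Set} {xs : List A} {ys : List B} → Unique xs →
                          (∀ {x} → x ∈ xs → ∃[ y ] y ∈ ys × R x y) →
                          (∀ {x x′ y} → R x y → R x′ y → x ≡ x′) →
                          length xs ≤ length ys
  length-≤-by-injection {R = R} {xs} {ys} unique partner R-injective = injective⇒≤ index-injective
    where
    partnerIndex : Fin (length xs) → Fin (length ys)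
    partnerIndex i = Any.index (proj₁ (proj₂ (partner (∈-lookup i))))
    index-injective : ∀ {i j} → partnerIndex i ≡ partnerIndex j → i ≡ j
    index-injective {i} {j} eq with partner (∈-lookup {xs = xs} i) | partner (∈-lookup {xs = xs} j)
    ... | y , y∈ys , R[xᵢ,y] | y′ , y′∈ys , R[xⱼ,y′] =
      lookup-injective unique (R-injective R[xᵢ,y] (subst (R _) y′≡y R[xⱼ,y′]))
      where
      open ≡-Reasoning
      y′≡y : y′ ≡ y
      y′≡y = begin
        y′                         ≡⟨ lookup-index y′∈ys ⟩
        lookup ys (Any.index y′∈ys) ≡⟨ cong (lookup ys) eq ⟨
        lookup ys (Any.index y∈ys)  ≡⟨ lookup-index y∈ys ⟨
        y                          ∎

pascal : ∀ N k → Fin (suc N C suc k) → Fin (N C k) ⊎ Fin (N C suc k)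
pascal N k = splitAt (N C k) ∘ cast (sym (nCk+nC[k+1]≡[n+1]C[k+1] N k))

pascal⁻¹ : ∀ N k → Fin (N C k) ⊎ Fin (N C suc k) → Fin (suc N C suc k)
pascal⁻¹ N k = cast (nCk+nC[k+1]≡[n+1]C[k+1] N k) ∘ join (N C k) (N C suc k)

pascal-pascal⁻¹ : ∀ N k s → pascal N k (pascal⁻¹ N k s) ≡ s
pascal-pascal⁻¹ N k s = trans (cong (splitAt (N C k)) (cast-involutive (sym rule) rule (join (N C k) (N C suc k) s)))
                              (splitAt-join (N C k) (N C suc k) s)
  where
  rule : N C k + N C suc k ≡ suc N C suc k
  rule = nCk+nC[k+1]≡[n+1]C[k+1] N k

subset : ∀ N k → Fin (N C k) → List ℕ
subset N       zero    _ = []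
subset zero    (suc k) ()
subset (suc N) (suc k) j = [ (N ∷_) ∘ subset N k , subset N (suc k) ]′ (pascal N k j)

subset-pascal⁻¹ : ∀ N k s → subset (suc N) (suc k) (pascal⁻¹ N k s) ≡ [ (N ∷_) ∘ subset N k , subset N (suc k) ]′ s
subset-pascal⁻¹ N k s = cong [ (N ∷_) ∘ subset N k , subset N (suc k) ]′ (pascal-pascal⁻¹ N k s)

subset-length : ∀ N k j → length (subset N k j) ≡ k
subset-length N       zero    _ = refl
subset-length (suc N) (suc k) j with pascal N k j
... | inj₁ a = cong suc (subset-length N k a)
... | inj₂ b = subset-length N (suc k) b

subset-< : ∀ N k j → All (_< N) (subset N k j)
subset-< N       zero    _ = []
subset-< (suc N) (suc k) j with pascal N k j
... | inj₁ a = ≤-refl ∷ All.map m<n⇒m<1+n (subset-< N k a)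
... | inj₂ b = All.map m<n⇒m<1+n (subset-< N (suc k) b)

subset-unique : ∀ N k j → Unique (subset N k j)
subset-unique N       zero    _ = []
subset-unique (suc N) (suc k) j with pascal N k j
... | inj₁ a = All.map (λ i<N N≡i → <-irrefl (sym N≡i) i<N) (subset-< N k a) ∷ subset-unique N k a
... | inj₂ b = subset-unique N (suc k) b

module _ {P : ℕ → Set} (P? : Decidable P) where

  subset-cover : ∀ N k → k ≤ length (filter P? (downFrom N)) → ∃[ j ] All P (subset N k j)
  subset-cover N       zero    _ = zero , []
  subset-cover zero    (suc k) ()
  subset-cover (suc N) (suc k) k<∣P∣ with P? N
  ... | yes PN = let a , Pa = subset-cover N k (s≤s⁻¹ k<∣P∣)
                 in pascal⁻¹ N k (inj₁ a) , subst (All P) (sym (subset-pascal⁻¹ N k (inj₁ a))) (PN ∷ Pa)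
  ... | no ¬PN = let b , Pb = subset-cover N (suc k) k<∣P∣
                 in pascal⁻¹ N k (inj₂ b) , subst (All P) (sym (subset-pascal⁻¹ N k (inj₂ b))) Pb

-- Repetitions from echoes

module _ (Γ : Graph) (level : Vertex Γ → ℕ) (φ : Vertex Γ → ℕ) where

  record Echo (y d : ℕ) : Set where
    field
      lower upper       : Vertex Γ
      lower-level       : level lower ≡ y
      upper-level       : level upper ≡ y + d
      same-colour       : φ lower ≡ φ upper

  repetitive-of-echoes : (∀ {u v} → suc (level u) ≡ level v → Adj Γ u v) →
                         ∀ x d → 1 ≤ d → ((a : Fin d) → Echo (x + toℕ a) d) → Repetitive Γ φ
  repetitive-of-echoes adjacent x d 1≤d echo = d , 1≤d , path , is-path , λ a →
    subst₂ (λ i j → φ (vertex i) ≡ φ (vertex j)) (sym (splitAt-↑ˡ d a d)) (sym (splitAt-↑ʳ d d a)) (Echo.same-colour (echo a))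
    where
    vertex : Fin d ⊎ Fin d → Vertex Γ
    vertex (inj₁ a) = Echo.lower (echo a)
    vertex (inj₂ a) = Echo.upper (echo a)
    path : Fin (d + d) → Vertex Γ
    path = vertex ∘ splitAt d
    path-level : ∀ i → level (path i) ≡ x + toℕ i
    path-level i with splitAt d i in split≡
    ... | inj₁ a = begin
      level (Echo.lower (echo a)) ≡⟨ Echo.lower-level (echo a) ⟩
      x + toℕ a                   ≡⟨ cong (x +_) (toℕ-↑ˡ a d) ⟨
      x + toℕ (a ↑ˡ d)            ≡⟨ cong (λ j → x + toℕ j) (splitAt⁻¹-↑ˡ split≡) ⟩
      x + toℕ i                   ∎
      where open ≡-Reasoning
    ... | inj₂ a = begin
      level (Echo.upper (echo a)) ≡⟨ Echo.upper-level (echo a) ⟩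
      x + toℕ a + d               ≡⟨ +-assoc x (toℕ a) d ⟩
      x + (toℕ a + d)             ≡⟨ cong (x +_) (trans (+-comm (toℕ a) d) (sym (toℕ-↑ʳ d a))) ⟩
      x + toℕ (d ↑ʳ a)            ≡⟨ cong (λ j → x + toℕ j) (splitAt⁻¹-↑ʳ split≡) ⟩
      x + toℕ i                   ∎
      where open ≡-Reasoning
    is-path : IsPath Γ (d + d) path
    is-path = record
      { distinct    = λ {i} {j} p[i]≡p[j] → toℕ-injective (+-cancelˡ-≡ x _ _
          (trans (sym (path-level i)) (trans (cong level p[i]≡p[j]) (path-level j))))
      ; consecutive = λ i j j≡1+i → adjacent (trans (cong suc (path-level i))
          (trans (sym (+-suc x (toℕ i))) (trans (cong (x +_) (sym j≡1+i)) (sym (path-level j)))))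
      }

-- Windows

t*d+a≡t′*d+a′⇒t≡t′ : ∀ {d t t′ a a′} → a < d → a′ < d → t * d + a ≡ t′ * d + a′ → t ≡ t′
t*d+a≡t′*d+a′⇒t≡t′ {d} {t} {t′} {a} {a′} a<d a′<d eq = begin
  t                   ≡⟨ quotient a<d ⟨
  (t * d + a) / d     ≡⟨ cong (_/ d) eq ⟩
  (t′ * d + a′) / d   ≡⟨ quotient a′<d ⟩
  t′                  ∎
  where
  open ≡-Reasoning
  instance
    d≢0 : NonZero d
    d≢0 = >-nonZero (≤-<-trans z≤n a<d)
  quotient : ∀ {t a} → a < d → (t * d + a) / d ≡ t
  quotient {t} {a} a<d = begin
    (t * d + a) / d     ≡⟨ +-distrib-/-∣ˡ a (n∣m*n t) ⟩
    t * d / d + a / d   ≡⟨ cong₂ _+_ (m*n/n≡m t d) (m<n⇒m/n≡0 a<d) ⟩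
    t + 0               ≡⟨ +-identityʳ t ⟩
    t                   ∎

parity : ∀ y → ∃[ q ] (2 * q ≡ y ⊎ suc (2 * q) ≡ y)
parity zero = 0 , inj₁ refl
parity (suc y) with parity y
... | q , inj₁ refl = q , inj₂ refl
... | q , inj₂ refl = suc q , inj₁ (cong suc (+-suc q (q + 0)))

module _ (n : ℕ) where

  -- Positions y and z carry the odd vertex k (at 2k) and the set e (at 2e + 1).
  data Straddle (y z : ℕ) (e k : Fin n) : Set where
    odd-even : y ≡ 2 * toℕ k → z ≡ suc (2 * toℕ e) → Straddle y z e k
    even-odd : y ≡ suc (2 * toℕ e) → z ≡ 2 * toℕ k → Straddle y z e k

  ∃-straddle : ∀ y s → y + suc (2 * s) < 2 * n → ∃₂ λ e k → Straddle y (y + suc (2 * s)) e k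
  ∃-straddle y s z<2n with parity y
  ... | q , inj₁ refl = fromℕ< q+s<n , fromℕ< q<n ,
        odd-even (cong (2 *_) (sym (toℕ-fromℕ< q<n))) (trans (even+odd q s) (cong (λ i → suc (2 * i)) (sym (toℕ-fromℕ< q+s<n))))
    where
    even+odd : ∀ q s → 2 * q + suc (2 * s) ≡ suc (2 * (q + s))
    even+odd = solve-∀
    q+s<n : q + s < n
    q+s<n = *-cancelˡ-< 2 _ _ (<-trans (n<1+n _) (subst (_< 2 * n) (even+odd q s) z<2n))
    q<n : q < n
    q<n = ≤-<-trans (m≤m+n q s) q+s<n
  ... | q , inj₂ refl = fromℕ< q<n , fromℕ< 1+q+s<n ,
        even-odd (cong (λ i → suc (2 * i)) (sym (toℕ-fromℕ< q<n))) (trans (odd+odd q s) (cong (2 *_) (sym (toℕ-fromℕ< 1+q+s<n))))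
    where
    odd+odd : ∀ q s → suc (2 * q) + suc (2 * s) ≡ 2 * suc (q + s)
    odd+odd = solve-∀
    1+q+s<n : suc (q + s) < n
    1+q+s<n = *-cancelˡ-< 2 _ _ (subst (_< 2 * n) (odd+odd q s) z<2n)
    q<n : q < n
    q<n = <-trans (s≤s (m≤m+n q s)) 1+q+s<n

  straddle-unique : ∀ {y z y′ z′ e k} → y < z → y′ < z′ → Straddle y z e k → Straddle y′ z′ e k → y ≡ y′ × z ≡ z′
  straddle-unique _   _     (odd-even y≡ z≡) (odd-even y′≡ z′≡) = trans y≡ (sym y′≡) , trans z≡ (sym z′≡)
  straddle-unique _   _     (even-odd y≡ z≡) (even-odd y′≡ z′≡) = trans y≡ (sym y′≡) , trans z≡ (sym z′≡)
  straddle-unique y<z y′<z′ (odd-even y≡ z≡) (even-odd y′≡ z′≡) =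
    ⊥-elim (<-asym (subst₂ _<_ y≡ z≡ y<z) (subst₂ _<_ y′≡ z′≡ y′<z′))
  straddle-unique y<z y′<z′ (even-odd y≡ z≡) (odd-even y′≡ z′≡) =
    ⊥-elim (<-asym (subst₂ _<_ y≡ z≡ y<z) (subst₂ _<_ y′≡ z′≡ y′<z′))

  -- (s , t) is the window of odd width d = 2s + 1 on the positions t·d, …, t·d + 2d - 1;
  -- it fits when (t + 2)(s + 1) ≤ n, which leaves ⌊n/(s+1)⌋ - 1 values of t.
  windows : ℕ → List (ℕ × ℕ)
  windows zero    = []
  windows (suc s) = map (s ,_) (downFrom (n / suc s ∸ 1)) ++ windows s

  length-windows : ∀ S → length (windows S) ≡ windowCount n S
  length-windows zero    = refl
  length-windows (suc S) = trans (length-++ (map (S ,_) (downFrom (n / suc S ∸ 1))))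
    (cong₂ _+_ (trans (length-map (S ,_) (downFrom (n / suc S ∸ 1))) (length-downFrom (n / suc S ∸ 1))) (length-windows S))

  ∈-windows⁻ : ∀ {S s t} → (s , t) ∈ windows S → s < S × t < n / suc s ∸ 1
  ∈-windows⁻ {suc S} st∈ with ∈-++⁻ (map (S ,_) (downFrom (n / suc S ∸ 1))) st∈
  ... | inj₁ st∈row with _ , t∈ , refl ← ∈-map⁻ (S ,_) st∈row = ≤-refl , ∈-downFrom⁻ t∈
  ... | inj₂ st∈    = map₁ m<n⇒m<1+n (∈-windows⁻ st∈)

  windows-unique : ∀ S → Unique (windows S)
  windows-unique zero    = []
  windows-unique (suc S) = ++⁺ (map⁺ (cong proj₂) (downFrom⁺ _)) (windows-unique S) λ (st∈row , st∈) →
    let _ , _ , s≡S = ∈-map⁻ (S ,_) st∈row in <-irrefl (cong proj₁ s≡S) (proj₁ (∈-windows⁻ st∈))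

  window-fits : ∀ {S s t} → (s , t) ∈ windows S → suc (suc t) * suc s ≤ n
  window-fits {S} {s} st∈ = ≤-trans (*-monoˡ-≤ (suc s) (2+t≤ (n / suc s) (proj₂ (∈-windows⁻ {S} st∈)))) (m/n*n≤m n (suc s))
    where
    2+t≤ : ∀ {t} x → t < x ∸ 1 → suc (suc t) ≤ x
    2+t≤ (suc x) t<x = s≤s t<x

  echo-bound : ∀ {s t a} → suc (suc t) * suc s ≤ n → a < suc (2 * s) → t * suc (2 * s) + a + suc (2 * s) < 2 * n
  echo-bound {s} {t} {a} fits a<d = begin-strict
    t * d + a + d               <⟨ +-monoˡ-< d (+-monoʳ-< (t * d) a<d) ⟩
    t * d + d + d               ≡⟨ two-more t d ⟩
    suc (suc t) * d             ≤⟨ *-monoʳ-≤ (suc (suc t)) (n≤1+n d) ⟩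
    suc (suc t) * suc d         ≡⟨ double t s ⟩
    2 * (suc (suc t) * suc s)   ≤⟨ *-monoʳ-≤ 2 fits ⟩
    2 * n                       ∎
    where
    open ≤-Reasoning
    d : ℕ
    d = suc (2 * s)
    two-more : ∀ t d → t * d + d + d ≡ suc (suc t) * d
    two-more = solve-∀
    double : ∀ t s → suc (suc t) * suc (suc (2 * s)) ≡ 2 * (suc (suc t) * suc s)
    double = solve-∀

-- Lists and colourings of G n ℓ

module _ (n ℓ : ℕ) where

  position : GVertex n ℓ → ℕ
  position (odd k)    = 2 * toℕ k
  position (even e _) = suc (2 * toℕ e)

  position-adjacent : ∀ {u v} → suc (position u) ≡ position v → Adj (G n ℓ) u v
  position-adjacent {u} {v} eq = inj₁ (trans (cong suc (lowerIndex≡1+position u)) (trans (cong suc eq) (sym (lowerIndex≡1+position v))))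
    where
    lowerIndex≡1+position : ∀ v → lowerIndex v ≡ suc (position v)
    lowerIndex≡1+position (odd _)    = refl
    lowerIndex≡1+position (even _ _) = refl

  block : Fin n → List ℕ
  block k = map (toℕ k * ℓ +_) (downFrom ℓ)

  lists : GVertex n ℓ → List ℕ
  lists (odd k)    = block k
  lists (even _ j) = subset (ℓ * n) ℓ j

  lists-valid : ∀ v → Unique (lists v) × ℓ ≤ length (lists v)
  lists-valid (odd k)    = map⁺ (+-cancelˡ-≡ (toℕ k * ℓ) _ _) (downFrom⁺ ℓ) ,
                           ≤-reflexive (sym (trans (length-map (toℕ k * ℓ +_) (downFrom ℓ)) (length-downFrom ℓ)))
  lists-valid (even _ j) = subset-unique (ℓ * n) ℓ j , ≤-reflexive (sym (subset-length (ℓ * n) ℓ j))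

  module _ (φ : GVertex n ℓ → ℕ) (φ∈lists : ∀ v → φ v ∈ lists v) (nonrep : Nonrepetitive (G n ℓ) φ) where

    col : Fin n → ℕ
    col k = φ (odd k)

    col-in-block : ∀ k → ∃[ i ] i < ℓ × col k ≡ toℕ k * ℓ + i
    col-in-block k with i , i∈ , col≡ ← ∈-map⁻ (toℕ k * ℓ +_) (φ∈lists (odd k)) = i , ∈-downFrom⁻ i∈ , col≡

    col-< : ∀ k → col k < ℓ * n
    col-< k with i , i<ℓ , col≡ ← col-in-block k = begin-strict
      col k              ≡⟨ col≡ ⟩
      toℕ k * ℓ + i      <⟨ +-monoʳ-< (toℕ k * ℓ) i<ℓ ⟩
      toℕ k * ℓ + ℓ      ≡⟨ +-comm (toℕ k * ℓ) ℓ ⟩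
      suc (toℕ k) * ℓ    ≤⟨ *-monoˡ-≤ ℓ (toℕ<n k) ⟩
      n * ℓ              ≡⟨ *-comm n ℓ ⟩
      ℓ * n              ∎
      where open ≤-Reasoning

    col-injective : ∀ {k k′} → col k ≡ col k′ → k ≡ k′
    col-injective {k} {k′} col≡col′ with i , i<ℓ , col≡ ← col-in-block k | i′ , i′<ℓ , col′≡ ← col-in-block k′ =
      toℕ-injective (t*d+a≡t′*d+a′⇒t≡t′ i<ℓ i′<ℓ (trans (sym col≡) (trans col≡col′ col′≡)))

    Missing : Fin n → ℕ → Set
    Missing e c = ∀ j → φ (even e j) ≢ c

    missing? : ∀ e c → Dec (Missing e c)
    missing? e c = all? λ j → ¬? (φ (even e j) ≟ c)

    missingColours : Fin n → List ℕ
    missingColours e = filter (missing? e) (downFrom (ℓ * n))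

    -- ℓ missing colours would form the list of a vertex of the set e, leaving it uncolourable.
    missingColours-< : ∀ e → length (missingColours e) < ℓ
    missingColours-< e = ≰⇒> λ ℓ≤ →
      let j , all-missing = subset-cover (missing? e) (ℓ * n) ℓ ℓ≤
      in All.lookup all-missing (φ∈lists (even e j)) j refl

    missingPairs : List (Fin n) → List (Fin n × ℕ)
    missingPairs []       = []
    missingPairs (e ∷ es) = map (e ,_) (missingColours e) ++ missingPairs es

    length-missingPairs : ∀ es → length (missingPairs es) ≤ length es * ℓ
    length-missingPairs []       = z≤n
    length-missingPairs (e ∷ es) = begin
      length (map (e ,_) (missingColours e) ++ missingPairs es)
        ≡⟨ length-++ (map (e ,_) (missingColours e)) ⟩
      length (map (e ,_) (missingColours e)) + length (missingPairs es)
        ≡⟨ cong (_+ length (missingPairs es)) (length-map (e ,_) (missingColours e)) ⟩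
      length (missingColours e) + length (missingPairs es)
        ≤⟨ +-mono-≤ (<⇒≤ (missingColours-< e)) (length-missingPairs es) ⟩
      ℓ + length es * ℓ
        ∎
      where open ≤-Reasoning

    ∈-missingPairs : ∀ {e c es} → e ∈ es → c < ℓ * n → Missing e c → (e , c) ∈ missingPairs es
    ∈-missingPairs {es = e ∷ _}  (here refl) c<N missing =
      ∈-++⁺ˡ (∈-map⁺ (e ,_) (∈-filter⁺ (missing? e) (∈-downFrom⁺ c<N) missing))
    ∈-missingPairs {es = e ∷ es} (there e∈)  c<N missing =
      ∈-++⁺ʳ (map (e ,_) (missingColours e)) (∈-missingPairs e∈ c<N missing)

    echo-of-straddle : ∀ {y d e k j} → Straddle n y (y + d) e k → φ (even e j) ≡ col k → Echo (G n ℓ) position φ y d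
    echo-of-straddle {e = e} {k} {j} (odd-even y≡ z≡) φ≡col = record
      { lower = odd k ; upper = even e j ; lower-level = sym y≡ ; upper-level = sym z≡ ; same-colour = sym φ≡col }
    echo-of-straddle {e = e} {k} {j} (even-odd y≡ z≡) φ≡col = record
      { lower = even e j ; upper = odd k ; lower-level = sym y≡ ; upper-level = sym z≡ ; same-colour = φ≡col }

    Blocks : ℕ × ℕ → Fin n × ℕ → Set
    Blocks (s , t) (e , c) = ∃₂ λ a k → a < suc (2 * s) ×
      Straddle n (t * suc (2 * s) + a) (t * suc (2 * s) + a + suc (2 * s)) e k × col k ≡ c

    -- The two positions determine d as their distance, and t as the quotient of the lower one by d.
    Blocks-injective : ∀ {w w′ ec} → Blocks w ec → Blocks w′ ec → w ≡ w′
    Blocks-injective {s , t} {s′ , t′} (a , k , a<d , str , colk≡c) (a′ , k′ , a′<d′ , str′ , colk′≡c)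
      with refl ← col-injective (trans colk≡c (sym colk′≡c))
      with y≡y′ , z≡z′ ← straddle-unique n (m<m+n _ (s≤s z≤n)) (m<m+n _ (s≤s z≤n)) str str′
      with refl ← *-cancelˡ-≡ s s′ 2 (suc-injective (+-cancelˡ-≡ _ _ _ (trans (cong (_+ suc (2 * s)) (sym y≡y′)) z≡z′)))
      = cong (s ,_) (t*d+a≡t′*d+a′⇒t≡t′ a<d a′<d′ y≡y′)

    module Window {s t : ℕ} (fits : suc (suc t) * suc s ≤ n) where

      d x : ℕ
      d = suc (2 * s)
      x = t * d

      straddles : (a : Fin d) → ∃₂ λ e k → Straddle n (x + toℕ a) (x + toℕ a + d) e k
      straddles a = ∃-straddle n (x + toℕ a) s (echo-bound n {s} {t} fits (toℕ<n a))

      e k : Fin d → Fin n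
      e a = proj₁ (straddles a)
      k a = proj₁ (proj₂ (straddles a))

      straddle-at : ∀ a → Straddle n (x + toℕ a) (x + toℕ a + d) (e a) (k a)
      straddle-at a = proj₂ (proj₂ (straddles a))

      echo : ∀ a → ¬ Missing (e a) (col (k a)) → Echo (G n ℓ) position φ (x + toℕ a) d
      echo a ¬missing = echo-of-straddle (straddle-at a) (proj₂ (∃-of-¬∀¬ (λ j → φ (even (e a) j) ≟ col (k a)) ¬missing))

      missing-offset : ∃[ a ] Missing (e a) (col (k a))
      missing-offset = ∃-of-¬∀¬ (λ a → missing? (e a) (col (k a))) λ none-missing →
        nonrep (repetitive-of-echoes (G n ℓ) position φ position-adjacent x d (s≤s z≤n) λ a → echo a (none-missing a))

      blocked : ∃[ ec ] ec ∈ missingPairs (allFin n) × Blocks (s , t) ec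
      blocked = let a , missing = missing-offset in
        (e a , col (k a)) , ∈-missingPairs (∈-allFin (e a)) (col-< (k a)) missing , toℕ a , k a , toℕ<n a , straddle-at a , refl

    window-blocked : ∀ {w} → w ∈ windows n n → ∃[ ec ] ec ∈ missingPairs (allFin n) × Blocks w ec
    window-blocked {s , t} st∈ = Window.blocked {s} {t} (window-fits n {n} {s} {t} st∈)

    windowCount≤n*ℓ : windowCount n n ≤ n * ℓ
    windowCount≤n*ℓ = begin
      windowCount n n                     ≡⟨ length-windows n n ⟨
      length (windows n n)                ≤⟨ length-≤-by-injection (windows-unique n n) window-blocked Blocks-injective ⟩
      length (missingPairs (allFin n))    ≤⟨ length-missingPairs (allFin n) ⟩
      length (allFin n) * ℓ               ≡⟨ cong (_* ℓ) (length-tabulate {A = Fin n} id) ⟩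
      n * ℓ                               ∎
      where open ≤-Reasoning

theorem3 : (ℓ n : ℕ) → 1 ≤ ℓ → ExpLessThan (ℓ + 2) n → ThueChoiceNumberExceeds (G n ℓ) ℓ
theorem3 ℓ n _ e^[ℓ+2]<n k k≤ℓ choosable
  with φ , φ∈lists , nonrep ← choosable (lists n ℓ) (map₂ (≤-trans k≤ℓ) ∘ lists-valid n ℓ)
  = <-irrefl refl (begin-strict
      n * ℓ             <⟨ windowCount-exceeds ℓ n (harmonic-exceeds (ℓ + 2) n e^[ℓ+2]<n) ⟩
      windowCount n n   ≤⟨ windowCount≤n*ℓ n ℓ φ φ∈lists nonrep ⟩
      n * ℓ             ∎)
  where open ≤-Reasoning
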